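{- Let $\Gamma$ be a commutative weakly distance-regular digraph with $(1,2)\in\tilde\partial(\Gamma)$. If $2p^{(2,1)}_{(1,2),(1,2)}>k_{1,2}$, then $p^{\tilde h}_{(1,2),(2,1)}\geq 2p^{(2,1)}_{(1,2),(1,2)}-k_{1,2}$ for each $\Gamma_{\tilde h}\in\Gamma_{1,2}\Gamma_{2,1}$.
   Context: All digraphs are finite, simple, strongly connected and not undirected. $\partial(x,y)$ is the directed distance, $\tilde{\partial}(x,y)=(\partial(x,y),\partial(y,x))$, $\tilde{\partial}(\Gamma)$ the set of all such pairs. Weakly distance-regular: for all $\tilde h,\tilde i,\tilde j\in\tilde\partial(\Gamma)$ the number $p^{\tilde h}_{\tilde i,\tilde j}$ of $z$ with $\tilde\partial(x,z)=\tilde i$, $\tilde\partial(z,y)=\tilde j$ depends only on $\tilde h=\tilde\partial(x,y)$; commutative: $p^{\tilde h}_{\tilde i,\tilde j}=p^{\tilde h}_{\tilde j,\tilde i}$. $k_{a,b}$ is the number of $y$ with $\tilde\partial(x,y)=(a,b)$. $\Gamma_{\tilde i}=\{(x,y):\tilde\partial(x,y)=\tilde i\}$, $\Gamma_{a,b}=\Gamma_{(a,b)}$, and $\Gamma_{\tilde i}\Gamma_{\tilde j}=\{\Gamma_{\tilde h}:p^{\tilde h}_{\tilde i,\tilde j}\neq0\}$. -}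

module Defs where

open import Data.Nat using (ℕ; zero; suc)
open import Data.Bool using (Bool; true; false; _∧_; _∨_; if_then_else_)
open import Data.Fin using (Fin)
open import Data.Fin.Properties using (_≟_)
open import Data.List using (List; length; filter)
open import Data.List using () renaming (allFin to allFinL)
open import Data.Product using (_×_; _,_; ∃; ∃-syntax; Σ)
open import Data.Product.Properties using (≡-dec)
open import Data.Nat.Properties using () renaming (_≟_ to _≟ℕ_)
open import Relation.Nullary.Decidable using (⌊_⌋)
open import Relation.Binary.PropositionalEquality using (_≡_)
open import Data.Bool.ListAction using (any)

Digraph : ℕ → Set
Digraph n = Fin n → Fin n → Bool

module _ {n : ℕ} (A : Digraph n) where

  reach : ℕ → Fin n → Fin n → Bool
  reach zero    x y = ⌊ x ≟ y ⌋
  reach (suc l) x y = reach l x y ∨ any (λ z → A x z ∧ reach l z y) (allFinL n)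

  distFrom : ℕ → ℕ → Fin n → Fin n → ℕ
  distFrom start zero     x y = start
  distFrom start (suc f)  x y =
    if reach start x y then start else distFrom (suc start) f x y

  -- directed distance ∂(x,y): length of a shortest directed path from x to y.
  -- (In a strongly connected digraph on n vertices it is < n, so the search
  --  over 0 … n always succeeds.)
  ∂ : Fin n → Fin n → ℕ
  ∂ x y = distFrom 0 n x y

  ∂~ : Fin n → Fin n → ℕ × ℕ
  ∂~ x y = ∂ x y , ∂ y x

  InD : ℕ × ℕ → Set
  InD i = ∃[ x ] ∃[ y ] (∂~ x y ≡ i)

  p : Fin n → Fin n → ℕ × ℕ → ℕ × ℕ → ℕ
  p x y i j = length (filter (λ z → ≡-dec _≟ℕ_ _≟ℕ_ (∂~ x z) i
                                  Relation.Nullary.Decidable.×-dec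
                                  ≡-dec _≟ℕ_ _≟ℕ_ (∂~ z y) j) (allFinL n))

  k : Fin n → ℕ × ℕ → ℕ
  k x i = length (filter (λ y → ≡-dec _≟ℕ_ _≟ℕ_ (∂~ x y) i) (allFinL n))

  Loopless : Set
  Loopless = ∀ x → A x x ≡ false

  StronglyConnected : Set
  StronglyConnected = ∀ x y → ∃[ l ] (reach l x y ≡ true)

  NotUndirected : Set
  NotUndirected = ∃[ x ] ∃[ y ] (A x y ≡ true × A y x ≡ false)

  WeaklyDistanceRegular : Set
  WeaklyDistanceRegular =
    ∀ x y x' y' → ∂~ x y ≡ ∂~ x' y' →
      ∀ i j → InD i → InD j → p x y i j ≡ p x' y' i j

  Commutative : Set
  Commutative = ∀ x y i j → InD i → InD j → p x y i j ≡ p x y j i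

{-# OPTIONS --safe #-}
-- Pick z with ∂~(u,z) = (1,2) and ∂~(z,v) = (2,1); then ∂~(z,u) = ∂~(z,v) = (2,1), so Γ_{1,2}(z)
-- contains p^{(2,1)}_{(1,2),(1,2)} vertices t with ∂~(t,u) = (1,2) and as many with ∂~(t,v) = (1,2).
-- Each t in both sets has ∂~(u,t) = (2,1) and ∂~(t,v) = (1,2), so by inclusion–exclusion
-- 2 p^{(2,1)}_{(1,2),(1,2)} ≤ k_{1,2} + p_{(2,1),(1,2)}(u,v), and commutativity turns the last term
-- into p_{(1,2),(2,1)}(u,v).
module Submission where

open import Defs
open import Data.Nat using (ℕ; suc; _+_; _*_; _∸_; _≤_; _<_)
open import Data.Nat.Properties
  using (+-suc; +-identityʳ; +-mono-≤; ≤-antisym; m≤n+o⇒m∸n≤o; module ≤-Reasoning)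
  renaming (_≟_ to _≟ℕ_)
open import Data.Fin using (Fin)
open import Data.Fin.Properties using (_≟_)
open import Data.Product using (_×_; _,_; proj₁; proj₂; ∃; ∃-syntax; swap)
open import Data.Product.Properties using (≡-dec)
open import Data.Sum using ([_,_])
open import Data.List using ([]; _∷_; length; filter; allFin)
open import Data.List.Properties using (filter-none)
open import Data.List.Relation.Unary.Any using (any?; satisfied)
open import Data.List.Relation.Unary.All.Properties using (¬Any⇒All¬)
open import Data.List.Relation.Binary.Sublist.Propositional using (⊆-refl)
open import Data.List.Relation.Binary.Sublist.Propositional.Properties
  using (filter⁺; length-mono-≤)
open import Relation.Binary.PropositionalEquality hiding ([_])
open import Relation.Binary.Definitions using (DecidableEquality)
open import Relation.Nullary using (yes; no; contradiction)
open import Relation.Nullary.Decidable using (_×-dec_)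
open import Relation.Unary using (Pred; Decidable; _⊆_)
open import Relation.Unary.Properties using (_∪?_; _∩?_)

module _ {a p q} {A : Set a} {P : Pred A p} {Q : Pred A q}
         (P? : Decidable P) (Q? : Decidable Q) where

  length-filter-mono : P ⊆ Q → ∀ xs → length (filter P? xs) ≤ length (filter Q? xs)
  length-filter-mono P⊆Q xs = length-mono-≤ (filter⁺ P? Q? (λ { refl → P⊆Q }) (⊆-refl {x = xs}))

  length-filter-∪-∩ : ∀ xs →
    length (filter P? xs) + length (filter Q? xs)
      ≡ length (filter (P? ∪? Q?) xs) + length (filter (P? ∩? Q?) xs)
  length-filter-∪-∩ [] = refl
  length-filter-∪-∩ (x ∷ xs) with P? x | Q? x | length-filter-∪-∩ xs
  ... | yes _ | yes _ | ih = cong suc (trans (+-suc _ _) (trans (cong suc ih) (sym (+-suc _ _))))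
  ... | yes _ | no  _ | ih = cong suc ih
  ... | no  _ | yes _ | ih = trans (+-suc _ _) (cong suc ih)
  ... | no  _ | no  _ | ih = ih

length-filter≢0⇒∃ : ∀ {a p} {A : Set a} {P : Pred A p} (P? : Decidable P) xs →
                    length (filter P? xs) ≢ 0 → ∃ P
length-filter≢0⇒∃ P? xs ≢0 with any? P? xs
... | yes some = satisfied some
... | no  none = contradiction (cong length (filter-none P? (¬Any⇒All¬ xs none))) ≢0

∂-refl : ∀ {n} (A : Digraph n) x → ∂ A x x ≡ 0
∂-refl {suc _} A x with x ≟ x
... | yes _  = refl
... | no x≢x = contradiction refl x≢x

module _ {n : ℕ} (A : Digraph n) where

  private
    _≟²_ : DecidableEquality (ℕ × ℕ)
    _≟²_ = ≡-dec _≟ℕ_ _≟ℕ_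

    at? : ∀ x i → Decidable (λ t → ∂~ A x t ≡ i)
    at? x i t = ∂~ A x t ≟² i

    between? : ∀ x y i j → Decidable (λ t → ∂~ A x t ≡ i × ∂~ A t y ≡ j)
    between? x y i j t = (∂~ A x t ≟² i) ×-dec (∂~ A t y ≟² j)

  InD-swap : ∀ {i} → InD A i → InD A (swap i)
  InD-swap (x , y , xy) = y , x , cong swap xy

  p≢0⇒∃ : ∀ {u v i j} → p A u v i j ≢ 0 → ∃[ z ] (∂~ A u z ≡ i × ∂~ A z v ≡ j)
  p≢0⇒∃ {u} {v} {i} {j} = length-filter≢0⇒∃ (between? u v i j) (allFin n)

  k≡p-diagonal : ∀ z i → k A z i ≡ p A z z i (swap i)
  k≡p-diagonal z i = ≤-antisym
    (length-filter-mono (at? z i) (between? z z i (swap i)) (λ e → e , cong swap e) (allFin n))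
    (length-filter-mono (between? z z i (swap i)) (at? z i) proj₁ (allFin n))

  k-regular : WeaklyDistanceRegular A → ∀ {i} → InD A i → ∀ z w → k A z i ≡ k A w i
  k-regular wdr {i} Di z w = begin
    k A z i              ≡⟨ k≡p-diagonal z i ⟩
    p A z z i (swap i)   ≡⟨ wdr z z w w ∂~-diag≡ i (swap i) Di (InD-swap Di) ⟩
    p A w w i (swap i)   ≡⟨ sym (k≡p-diagonal w i) ⟩
    k A w i              ∎
    where
    open ≡-Reasoning
    ∂-diag≡ : ∂ A z z ≡ ∂ A w w
    ∂-diag≡ = trans (∂-refl A z) (sym (∂-refl A w))
    ∂~-diag≡ : ∂~ A z z ≡ ∂~ A w w
    ∂~-diag≡ = cong₂ _,_ ∂-diag≡ ∂-diag≡

  p+p≤k+p : ∀ z u v i j l → p A z u i j + p A z v i l ≤ k A z i + p A u v (swap j) l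
  p+p≤k+p z u v i j l = begin
    p A z u i j + p A z v i l
      ≡⟨ length-filter-∪-∩ Su Sv (allFin n) ⟩
    length (filter (Su ∪? Sv) (allFin n)) + length (filter (Su ∩? Sv) (allFin n))
      ≤⟨ +-mono-≤ (length-filter-mono (Su ∪? Sv) (at? z i) [ proj₁ , proj₁ ] (allFin n))
                  (length-filter-mono (Su ∩? Sv) (between? u v (swap j) l)
                                      (λ (zut , zvt) → cong swap (proj₂ zut) , proj₂ zvt)
                                      (allFin n)) ⟩
    k A z i + p A u v (swap j) l ∎
    where
    open ≤-Reasoning
    Su : Decidable (λ t → ∂~ A z t ≡ i × ∂~ A t u ≡ j)
    Su = between? z u i j
    Sv : Decidable (λ t → ∂~ A z t ≡ i × ∂~ A t v ≡ l)
    Sv = between? z v i l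

lemma2p5 : (n : ℕ) (A : Digraph n) →
    Loopless A → StronglyConnected A → NotUndirected A →
    WeaklyDistanceRegular A → Commutative A →
    InD A (1 , 2) →
    ∀ (x y : Fin n) → ∂~ A x y ≡ (2 , 1) →
    ∀ (w : Fin n) →
    k A w (1 , 2) < 2 * p A x y (1 , 2) (1 , 2) →
    ∀ (u v : Fin n) → p A u v (1 , 2) (2 , 1) ≢ 0 →
    2 * p A x y (1 , 2) (1 , 2) ∸ k A w (1 , 2) ≤ p A u v (1 , 2) (2 , 1)
lemma2p5 n A _ _ _ wdr com D₁₂ x y xy w _ u v p≢0 =
  m≤n+o⇒m∸n≤o (2 * P) (k A w (1 , 2)) (begin
    2 * P                                               ≡⟨ cong (P +_) (+-identityʳ P) ⟩
    P + P                                               ≡⟨ cong₂ _+_ (P-at zu) (P-at zv) ⟨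
    p A z u (1 , 2) (1 , 2) + p A z v (1 , 2) (1 , 2)   ≤⟨ p+p≤k+p A z u v (1 , 2) (1 , 2) (1 , 2) ⟩
    k A z (1 , 2) + p A u v (2 , 1) (1 , 2)             ≡⟨ cong₂ _+_ (k-regular A wdr D₁₂ z w)
                                                                   (com u v (2 , 1) (1 , 2) D₂₁ D₁₂) ⟩
    k A w (1 , 2) + p A u v (1 , 2) (2 , 1)             ∎)
  where
  open ≤-Reasoning
  P : ℕ
  P = p A x y (1 , 2) (1 , 2)
  D₂₁ : InD A (2 , 1)
  D₂₁ = x , y , xy
  z : Fin n
  z = proj₁ (p≢0⇒∃ A p≢0)
  zu : ∂~ A z u ≡ (2 , 1)
  zu = cong swap (proj₁ (proj₂ (p≢0⇒∃ A p≢0)))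
  zv : ∂~ A z v ≡ (2 , 1)
  zv = proj₂ (proj₂ (p≢0⇒∃ A p≢0))
  P-at : ∀ {t} → ∂~ A z t ≡ (2 , 1) → p A z t (1 , 2) (1 , 2) ≡ P
  P-at zt = wdr z _ x y (trans zt (sym xy)) (1 , 2) (1 , 2) D₁₂ D₁₂
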